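{- For each $g\ge3$, there exists a congruence family of genus $g$ hyperelliptic curves over $\mathbb{Q}$ with a rational Weierstrass point $\infty$ such that every curve $C$ in the family has good reduction at $3$ and satisfies $C_{\mathbb{F}_3}(\mathbb{F}_3)=\{\overline{\infty}\}$ and $C_{\mathbb{F}_3}(\mathbb{F}_9)=\{\overline\infty,(0,\pm\alpha),(1,\pm\alpha),(2,\pm\alpha)\}$ for some $\alpha\in\mathbb{F}_9\setminus\mathbb{F}_3$.
   Context: Each genus $g$ hyperelliptic curve over $\mathbb{Q}$ with a marked rational Weierstrass point $\infty$ has a unique minimal model $y^2=x^{2g+1}+a_2x^{2g-1}+\dots+a_{2g+1}$ with $a_i\in\mathbb{Z}$, separable right side, $\infty$ at infinity, and no prime $\ell$ with $\ell^{2i}\mid a_i$ for all $i\ge2$. A congruence family is the set of all such curves whose minimal-model coefficients satisfy a given finite set of congruence conditions. $C_{\mathbb{F}_3}$ denotes the reduction of the minimal model modulo $3$ (with its point at infinity $\overline\infty$). -}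

module Defs where

open import Data.Nat using (ℕ; zero; suc; _≤ᵇ_; _<ᵇ_; _∸_; _≥_; _^_) renaming (_+_ to _+ℕ_; _*_ to _*ℕ_)
open import Data.Nat.Divisibility using () renaming (_∣_ to _∣ℕ_)
open import Data.Nat.Primality using (Prime)
open import Data.Nat.DivMod using (_mod_)
open import Data.Integer using (ℤ; +_; -_; _+_; _*_; _-_; ∣_∣; _%ℕ_)
open import Data.Integer.Divisibility using () renaming (_∣_ to _∣ℤ_)
open import Data.Fin using (Fin; toℕ; punchIn) renaming (zero to fz; suc to fs)
open import Data.Vec using (Vec; lookup; toList)
open import Data.List using (List; []; _∷_; foldl)
open import Data.Bool using (Bool; if_then_else_; _∧_)
open import Data.Product using (Σ; _×_; _,_)
open import Data.Sum using (_⊎_)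
open import Relation.Nullary using (¬_)
open import Relation.Binary.PropositionalEquality using (_≡_; _≢_)
open import Function using (_∘_)
open import Function.Bundles using (_⇔_)

-- Curves  y² = x^(2g+1) + a₂ x^(2g-1) + … + a_(2g+1)
-- A model is given by the vector (a₂,…,a_(2g+1)) ∈ ℤ^(2g):
-- entry  i : Fin (2g)  is the coefficient  a_(i+2).

Coeffs : ℕ → Set
Coeffs g = Vec ℤ (2 *ℕ g)

deg : ℕ → ℕ
deg g = suc (2 *ℕ g)

-- coefficients of f in descending order: x^(2g+1), x^(2g), …, x^0
fDesc : (g : ℕ) → Coeffs g → List ℤ
fDesc g a = + 1 ∷ + 0 ∷ toList a

nth : List ℤ → ℕ → ℤ
nth []       _       = + 0
nth (x ∷ xs) zero    = x
nth (x ∷ xs) (suc k) = nth xs k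

sumFin : (n : ℕ) → (Fin n → ℤ) → ℤ
sumFin zero    f = + 0
sumFin (suc n) f = f fz + sumFin n (f ∘ fs)

sign : ℕ → ℤ
sign zero    = + 1
sign (suc k) = - sign k

det : (n : ℕ) → (Fin n → Fin n → ℤ) → ℤ
det zero    M = + 1
det (suc n) M =
  sumFin (suc n) (λ j → sign (toℕ j) * M fz j * det n (λ r s → M (fs r) (punchIn j s)))

-- Resultant Res(f, f') via the Sylvester matrix; for monic f this is
-- ± the discriminant of f.

sylEntry : ℕ → (ℕ → ℤ) → ℕ → ℕ → ℤ
sylEntry n c i j =
  if i <ᵇ (n ∸ 1)
  then (if (i ≤ᵇ j) ∧ ((j ∸ i) ≤ᵇ n) then c (j ∸ i) else + 0)
  else (if (k ≤ᵇ j) ∧ ((j ∸ k) ≤ᵇ (n ∸ 1)) then d (j ∸ k) else + 0)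
  where
    k = i ∸ (n ∸ 1)
    d : ℕ → ℤ
    d m = + (n ∸ m) * c m

resultantFF' : (g : ℕ) → Coeffs g → ℤ
resultantFF' g a =
  det (n +ℕ (n ∸ 1)) (λ i j → sylEntry n (nth (fDesc g a)) (toℕ i) (toℕ j))
  where n = deg g

Separable : (g : ℕ) → Coeffs g → Set
Separable g a = resultantFF' g a ≢ + 0

Minimal : (g : ℕ) → Coeffs g → Set
Minimal g a = ¬ Σ ℕ (λ ℓ → Prime ℓ ×
  ((i : Fin (2 *ℕ g)) → (ℓ ^ (2 *ℕ (toℕ i +ℕ 2))) ∣ℕ ∣ lookup a i ∣))

MinimalModel : (g : ℕ) → Coeffs g → Set
MinimalModel g a = Separable g a × Minimal g a

-- good reduction at 3 of the minimal model: f mod 3 is separable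
GoodReductionAt3 : (g : ℕ) → Coeffs g → Set
GoodReductionAt3 g a = ¬ ((+ 3) ∣ℤ resultantFF' g a)

-- the condition  a_(idx+2) ≡ residue (mod modulus)
record CongCond (g : ℕ) : Set where
  constructor cong-cond
  field
    idx      : Fin (2 *ℕ g)
    modulus  : ℕ
    residue  : ℤ

ValidCond : {g : ℕ} → CongCond g → Set
ValidCond c = CongCond.modulus c ≥ 1

SatCond : {g : ℕ} → Coeffs g → CongCond g → Set
SatCond a c = (+ CongCond.modulus c) ∣ℤ (lookup a (CongCond.idx c) - CongCond.residue c)

-- 𝔽₃ and 𝔽₉ = 𝔽₃[i]/(i² + 1)

F3 : Set
F3 = Fin 3

toF3 : ℕ → F3
toF3 n = n mod 3

_+₃_ _*₃_ : F3 → F3 → F3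
x +₃ y = toF3 (toℕ x +ℕ toℕ y)
x *₃ y = toF3 (toℕ x *ℕ toℕ y)

neg₃ : F3 → F3
neg₃ x = toF3 (2 *ℕ toℕ x)

redℤ : ℤ → F3
redℤ z = toF3 (z %ℕ 3)

-- u + v·i
F9 : Set
F9 = F3 × F3

_+₉_ _*₉_ : F9 → F9 → F9
(a , b) +₉ (c , d) = (a +₃ c , b +₃ d)
(a , b) *₉ (c , d) = ((a *₃ c) +₃ neg₃ (b *₃ d) , (a *₃ d) +₃ (b *₃ c))

neg₉ : F9 → F9
neg₉ (a , b) = (neg₃ a , neg₃ b)

0₉ : F9
0₉ = (fz , fz)

embed : F3 → F9
embed a = (a , fz)

InF3 : F9 → Set
InF3 (u , v) = v ≡ fz

evalF9 : List ℤ → F9 → F9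
evalF9 cs x = foldl (λ acc c → (acc *₉ x) +₉ embed (redℤ c)) 0₉ cs

OnCurve : (g : ℕ) → Coeffs g → F9 → F9 → Set
OnCurve g a x y = y *₉ y ≡ evalF9 (fDesc g a) x

OnlyInfinityOverF3 : (g : ℕ) → Coeffs g → Set
OnlyInfinityOverF3 g a = (x y : F9) → InF3 x → InF3 y → ¬ OnCurve g a x y

F9PointsShape : (g : ℕ) → Coeffs g → Set
F9PointsShape g a = Σ F9 (λ α → (¬ InF3 α) ×
  ((x y : F9) → OnCurve g a x y ⇔ (InF3 x × (y ≡ α ⊎ y ≡ neg₉ α))))

-- Everything is decided modulo 3, where a model reduces to y² = f̄(x). The point conditions say
-- that f̄ = -1 on 𝔽₃ (a non-square there, with square roots ±i in 𝔽₉) and that f̄ takes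
-- non-square values on 𝔽₉ ∖ 𝔽₃. Good reduction means 3 ∤ Res(f, f′); when f̄′ = v·x^k with v a
-- unit, Laplace expansion of the Sylvester matrix leaves a single term, a product of units
-- (the leading coefficient 1, f̄(0) = -1 and v). Replacing x^(2g+1) by x^(2g+25) preserves both
-- properties, since x^24 = 1 on 𝔽₉ˣ and 24 ≡ 0 (mod 3), so explicit f̄ for g = 4, 5, 7, …, 18
-- cover every g ≥ 4 other than 6. For g = 3 and g = 6 the resultant of an explicit model is
-- evaluated. The family consists of the curves congruent to the model modulo 3; the constant
-- term -1 makes the model itself minimal.

module Submission where

open import Defs
open import Data.Bool using (Bool; true; false; if_then_else_; _∧_; _∨_; not; T)
open import Data.Bool.Properties using (T-≡; T-∧; T-∨)
open import Data.Empty using (⊥-elim)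
open import Data.Fin using (Fin; toℕ; fromℕ; fromℕ<; punchIn; punchOut) renaming (zero to fz; suc to fs)
import Data.Fin.Properties as FinP
open import Data.Integer using (ℤ; +_; -_; _+_; _*_; _-_; ∣_∣; _%ℕ_; _/ℕ_; 0ℤ; 1ℤ; -1ℤ)
import Data.Integer.DivMod as ℤDM
import Data.Integer.Divisibility as Unsigned
open import Data.Integer.Divisibility.Signed
  using (_∣_; divides; _∣?_; ∣m⇒∣-m; ∣m∣n⇒∣m+n; ∣m∣n⇒∣m-n; ∣n⇒∣m*n; ∣m⇒∣m*n; ∣-refl; ∣ᵤ⇒∣; ∣⇒∣ᵤ)
import Data.Integer.Properties as ℤP
open import Data.Integer.Tactic.RingSolver using (solve-∀)
open import Data.List as List using (List; []; _∷_; foldl)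
import Data.List.Properties as LP
open import Data.List.Relation.Unary.All using (All)
open import Data.List.Relation.Unary.All.Properties using (tabulate⁺; tabulate⁻)
open import Data.Nat using (ℕ; zero; suc; z≤n; s≤s; _≤_; _<_; _∸_; _≡ᵇ_; _<ᵇ_; _≤ᵇ_; NonZero)
  renaming (_+_ to _+ℕ_; _*_ to _*ℕ_)
import Data.Nat.Divisibility as ℕ∣
open import Data.Nat.Primality using (Prime; ¬prime[1])
import Data.Nat.Properties as ℕP
open import Data.Nat.Tactic.RingSolver using () renaming (solve-∀ to ℕ-solve-∀)
open import Data.Product using (Σ; _×_; _,_; proj₁; proj₂)
open import Data.Product.Properties using (≡-dec)
open import Data.Sum using (_⊎_; inj₁; inj₂)
open import Data.Vec as Vec using (Vec; []; _∷_; lookup; toList; removeAt; tabulate)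
import Data.Vec.Properties as VecP
open import Function using (_∘_; Equivalence; mk⇔)
open import Relation.Binary using (IsEquivalence; Setoid; tri<; tri≈; tri>)
open import Relation.Binary.Definitions using (DecidableEquality)
open import Relation.Binary.PropositionalEquality
import Relation.Binary.Reasoning.Setoid as SetoidReasoning
open import Relation.Nullary using (¬_; Dec; yes; no; ¬?; _×-dec_)
open import Relation.Nullary.Decidable using (True; map′; toWitness)

-- Congruences of integers

module Congruence (m : ℕ) where

  infix 4 _≈_
  record _≈_ (x y : ℤ) : Set where
    constructor mk≈
    field m∣x-y : + m ∣ x - y

  open _≈_ public

  private
    diff-sym : ∀ x y → y - x ≡ - (x - y)
    diff-sym = solve-∀

    diff-trans : ∀ x y z → x - z ≡ (x - y) + (y - z)
    diff-trans = solve-∀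

    diff-+ : ∀ x y x′ y′ → (x + y) - (x′ + y′) ≡ (x - x′) + (y - y′)
    diff-+ = solve-∀

    diff-* : ∀ x y x′ y′ → x * y - x′ * y′ ≡ x * (y - y′) + (x - x′) * y′
    diff-* = solve-∀

    cancel-diff : ∀ x y → y ≡ x - (x - y)
    cancel-diff = solve-∀

  ≈-refl : ∀ {x} → x ≈ x
  ≈-refl {x} = mk≈ (subst (+ m ∣_) (sym (ℤP.+-inverseʳ x)) (divides 0ℤ refl))

  ≈-reflexive : ∀ {x y} → x ≡ y → x ≈ y
  ≈-reflexive refl = ≈-refl

  ≈-sym : ∀ {x y} → x ≈ y → y ≈ x
  ≈-sym {x} {y} (mk≈ d) = mk≈ (subst (+ m ∣_) (sym (diff-sym x y)) (∣m⇒∣-m d))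

  ≈-trans : ∀ {x y z} → x ≈ y → y ≈ z → x ≈ z
  ≈-trans {x} {y} {z} (mk≈ d) (mk≈ e) =
    mk≈ (subst (+ m ∣_) (sym (diff-trans x y z)) (∣m∣n⇒∣m+n d e))

  +-cong : ∀ {x y x′ y′} → x ≈ x′ → y ≈ y′ → x + y ≈ x′ + y′
  +-cong {x} {y} {x′} {y′} (mk≈ d) (mk≈ e) =
    mk≈ (subst (+ m ∣_) (sym (diff-+ x y x′ y′)) (∣m∣n⇒∣m+n d e))

  *-cong : ∀ {x y x′ y′} → x ≈ x′ → y ≈ y′ → x * y ≈ x′ * y′
  *-cong {x} {y} {x′} {y′} (mk≈ d) (mk≈ e) =
    mk≈ (subst (+ m ∣_) (sym (diff-* x y x′ y′)) (∣m∣n⇒∣m+n (∣n⇒∣m*n x e) (∣m⇒∣m*n y′ d)))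

  ≈-isEquivalence : IsEquivalence _≈_
  ≈-isEquivalence = record { refl = ≈-refl ; sym = ≈-sym ; trans = ≈-trans }

  ≈-setoid : Setoid _ _
  ≈-setoid = record { isEquivalence = ≈-isEquivalence }

  module ≈-Reasoning = SetoidReasoning ≈-setoid

  +[k*m+a]≈+a : ∀ k a → + (k *ℕ m +ℕ a) ≈ + a
  +[k*m+a]≈+a k a = mk≈ (subst (+ m ∣_) (sym difference) (∣n⇒∣m*n (+ k) ∣-refl))
    where
    cancel : ∀ x y → (x + y) - y ≡ x
    cancel = solve-∀
    difference : + (k *ℕ m +ℕ a) - + a ≡ + k * + m
    difference = trans (cong (_- + a) (trans (ℤP.pos-+ (k *ℕ m) a) (cong (_+ + a) (ℤP.pos-* k m))))
                       (cancel (+ k * + m) (+ a))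

  _≈?_ : ∀ x y → Dec (x ≈ y)
  x ≈? y = map′ mk≈ m∣x-y (+ m ∣? x - y)

  ∣-resp-≈ : ∀ {x y} → x ≈ y → + m Unsigned.∣ x → + m Unsigned.∣ y
  ∣-resp-≈ {x} {y} (mk≈ d) m∣x =
    ∣⇒∣ᵤ (subst (+ m ∣_) (sym (cancel-diff x y)) (∣m∣n⇒∣m-n {+ m} {x} (∣ᵤ⇒∣ m∣x) d))

  residue-unique : ∀ {a b} → a < m → b < m → + a ≈ + b → a ≡ b
  residue-unique {a} {b} a<m b<m (mk≈ d) =
    ℤP.+-injective (ℤP.i-j≡0⇒i≡j (+ a) (+ b) (ℤP.∣i∣≡0⇒i≡0 ∣a-b∣≡0))
    where
    ∣a-b∣<m : ∣ + a - + b ∣ < m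
    ∣a-b∣<m = subst (_< m) (cong ∣_∣ (sym (ℤP.m-n≡m⊖n a b)))
                (ℕP.≤-<-trans (ℤP.∣m⊝n∣≤m⊔n a b) (ℕP.⊔-lub a<m b<m))
    ∣a-b∣≡0 : ∣ + a - + b ∣ ≡ 0
    ∣a-b∣≡0 with ∣ + a - + b ∣ in eq | ∣⇒∣ᵤ d
    ... | zero  | _   = refl
    ... | suc k | m∣k = ⊥-elim (ℕ∣.>⇒∤ (subst (_< m) eq ∣a-b∣<m) m∣k)

  %ℕ-cong : ∀ {x y} .{{_ : NonZero m}} → x ≈ y → x %ℕ m ≡ y %ℕ m
  %ℕ-cong {x} {y} x≈y = residue-unique (ℤDM.n%ℕd<d x m) (ℤDM.n%ℕd<d y m)
    (≈-trans (≈-sym (decomposition x)) (≈-trans x≈y (decomposition y)))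
    where
    decomposition : ∀ z → z ≈ + (z %ℕ m)
    decomposition z = mk≈ (subst (+ m ∣_) (sym eq) (∣n⇒∣m*n (z /ℕ m) ∣-refl))
      where
      split : ∀ r q k → (r + q * k) - r ≡ q * k
      split = solve-∀
      eq : z - + (z %ℕ m) ≡ (z /ℕ m) * + m
      eq = trans (cong (_- + (z %ℕ m)) (ℤDM.a≡a%ℕn+[a/ℕn]*n z m)) (split (+ (z %ℕ m)) (z /ℕ m) (+ m))

-- Laplace expansion

minor : ∀ {k} → (Fin (suc k) → Fin (suc k) → ℤ) → Fin (suc k) → Fin k → Fin k → ℤ
minor M j r c = M (fs r) (punchIn j c)

sumFin-cong : ∀ n {f f′ : Fin n → ℤ} → (∀ j → f j ≡ f′ j) → sumFin n f ≡ sumFin n f′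
sumFin-cong zero    h = refl
sumFin-cong (suc n) h = cong₂ _+_ (h fz) (sumFin-cong n (h ∘ fs))

sumFin-zero : ∀ n {f : Fin n → ℤ} → (∀ j → f j ≡ 0ℤ) → sumFin n f ≡ 0ℤ
sumFin-zero n h = trans (sumFin-cong n h) (vanish n)
  where
  vanish : ∀ n → sumFin n (λ _ → 0ℤ) ≡ 0ℤ
  vanish zero    = refl
  vanish (suc n) = trans (ℤP.+-identityˡ _) (vanish n)

sumFin-single : ∀ n {f : Fin n → ℤ} j₀ → (∀ j → j ≢ j₀ → f j ≡ 0ℤ) → sumFin n f ≡ f j₀
sumFin-single (suc n) {f} fz h = begin
  f fz + sumFin n (f ∘ fs) ≡⟨ cong (_+_ (f fz)) (sumFin-zero n (λ j → h (fs j) λ ())) ⟩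
  f fz + 0ℤ                ≡⟨ ℤP.+-identityʳ (f fz) ⟩
  f fz                     ∎
  where open ≡-Reasoning
sumFin-single (suc n) {f} (fs j₀) h = begin
  f fz + sumFin n (f ∘ fs) ≡⟨ cong (_+ sumFin n (f ∘ fs)) (h fz λ ()) ⟩
  0ℤ + sumFin n (f ∘ fs)   ≡⟨ ℤP.+-identityˡ _ ⟩
  sumFin n (f ∘ fs)        ≡⟨ sumFin-single n j₀ (λ j j≢j₀ → h (fs j) (j≢j₀ ∘ FinP.suc-injective)) ⟩
  f (fs j₀)                ∎
  where open ≡-Reasoning

det-cong : ∀ k {M M′ : Fin k → Fin k → ℤ} → (∀ r c → M r c ≡ M′ r c) → det k M ≡ det k M′
det-cong zero    h = refl
det-cong (suc k) h = sumFin-cong (suc k) λ j →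
  cong₂ (λ a b → sign (toℕ j) * a * b) (h fz j) (det-cong k λ r c → h (fs r) (punchIn j c))

module _ {m : ℕ} where
  open Congruence m

  sumFin-cong-≈ : ∀ n {f f′ : Fin n → ℤ} → (∀ j → f j ≈ f′ j) → sumFin n f ≈ sumFin n f′
  sumFin-cong-≈ zero    h = ≈-refl
  sumFin-cong-≈ (suc n) h = +-cong (h fz) (sumFin-cong-≈ n (h ∘ fs))

  det-cong-≈ : ∀ k {M M′ : Fin k → Fin k → ℤ} → (∀ r c → M r c ≈ M′ r c) → det k M ≈ det k M′
  det-cong-≈ zero    h = ≈-refl
  det-cong-≈ (suc k) h = sumFin-cong-≈ (suc k) λ j →
    *-cong (*-cong (≈-refl {sign (toℕ j)}) (h fz j)) (det-cong-≈ k λ r c → h (fs r) (punchIn j c))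

laplaceTerm-zero : ∀ {k} (M : Fin (suc k) → Fin (suc k) → ℤ) j →
  M fz j ≡ 0ℤ ⊎ det k (minor M j) ≡ 0ℤ → sign (toℕ j) * M fz j * det k (minor M j) ≡ 0ℤ
laplaceTerm-zero M j (inj₁ entry≡0) rewrite entry≡0 | ℤP.*-zeroʳ (sign (toℕ j)) = refl
laplaceTerm-zero M j (inj₂ det≡0)   rewrite det≡0 = ℤP.*-zeroʳ (sign (toℕ j) * M fz j)

det-zero-row : ∀ k (M : Fin k → Fin k → ℤ) r → (∀ c → M r c ≡ 0ℤ) → det k M ≡ 0ℤ
det-zero-row (suc k) M fz     h = sumFin-zero (suc k) λ j → laplaceTerm-zero M j (inj₁ (h j))
det-zero-row (suc k) M (fs r) h = sumFin-zero (suc k) λ j →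
  laplaceTerm-zero M j (inj₂ (det-zero-row k (minor M j) r (h ∘ punchIn j)))

det-zero-col : ∀ k (M : Fin k → Fin k → ℤ) c → (∀ r → M r c ≡ 0ℤ) → det k M ≡ 0ℤ
det-zero-col (suc k) M c h = sumFin-zero (suc k) λ j → laplaceTerm-zero M j (vanishing j)
  where
  vanishing : ∀ j → M fz j ≡ 0ℤ ⊎ det k (minor M j) ≡ 0ℤ
  vanishing j with j FinP.≟ c
  ... | yes refl = inj₁ (h fz)
  ... | no j≢c   = inj₂ (det-zero-col k (minor M j) (punchOut j≢c)
                    λ r → trans (cong (M (fs r)) (FinP.punchIn-punchOut j≢c)) (h (fs r)))

det-pivot : ∀ k (M : Fin (suc k) → Fin (suc k) → ℤ) j₀ →
  (∀ j → j ≢ j₀ → M fz j ≡ 0ℤ ⊎ det k (minor M j) ≡ 0ℤ) →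
  det (suc k) M ≡ sign (toℕ j₀) * M fz j₀ * det k (minor M j₀)
det-pivot k M j₀ h = sumFin-single (suc k) j₀ λ j j≢j₀ → laplaceTerm-zero M j (h j j≢j₀)

lookup-removeAt : ∀ {A : Set} {k} (xs : Vec A (suc k)) i j →
  lookup (removeAt xs i) j ≡ lookup xs (punchIn i j)
lookup-removeAt xs i j =
  trans (cong (lookup (removeAt xs i)) (sym (FinP.punchOut-punchIn i)))
        (VecP.removeAt-punchOut xs (FinP.punchInᵢ≢i i j ∘ sym))

-- For evaluating concrete determinants: Laplace expansion skipping the terms with a zero entry or a
-- minor with a visible zero row. Rows and columns carry natural-number labels, so that minors are
-- cheap to form.
module PrunedExpansion (E : ℕ → ℕ → ℤ) where

  labelled : ∀ {k} → Vec ℕ k → Vec ℕ k → Fin k → Fin k → ℤ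
  labelled ρ σ r c = E (lookup ρ r) (lookup σ c)

  isZero : ℤ → Bool
  isZero (+ zero) = true
  isZero _        = false

  isZero-sound : ∀ z → T (isZero z) → z ≡ 0ℤ
  isZero-sound (+ zero) _ = refl

  vanishesOn : ℕ → ∀ {k} → Vec ℕ k → Bool
  vanishesOn r []      = true
  vanishesOn r (y ∷ σ) = isZero (E r y) ∧ vanishesOn r σ

  -- After deleting column x, only rows with a nonzero entry in x can have become zero.
  zeroRowAfterDeleting : ℕ → ∀ {k k′} → Vec ℕ k → Vec ℕ k′ → Bool
  zeroRowAfterDeleting x []      σ = false
  zeroRowAfterDeleting x (r ∷ ρ) σ =
    (not (isZero (E r x)) ∧ vanishesOn r σ) ∨ zeroRowAfterDeleting x ρ σ

  vanishesOn-sound : ∀ r {k} (σ : Vec ℕ k) → T (vanishesOn r σ) → ∀ c → E r (lookup σ c) ≡ 0ℤ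
  vanishesOn-sound r (y ∷ σ) t fz     = isZero-sound (E r y) (proj₁ (Equivalence.to T-∧ t))
  vanishesOn-sound r (y ∷ σ) t (fs c) = vanishesOn-sound r σ (proj₂ (Equivalence.to T-∧ t)) c

  zeroRowAfterDeleting-sound : ∀ x {k k′} (ρ : Vec ℕ k) (σ : Vec ℕ k′) →
    T (zeroRowAfterDeleting x ρ σ) → Σ (Fin k) λ r → ∀ c → E (lookup ρ r) (lookup σ c) ≡ 0ℤ
  zeroRowAfterDeleting-sound x (r ∷ ρ) σ t with Equivalence.to T-∨ t
  ... | inj₁ t₁ = fz , vanishesOn-sound r σ (proj₂ (Equivalence.to T-∧ t₁))
  ... | inj₂ t₂ = let r′ , h = zeroRowAfterDeleting-sound x ρ σ t₂ in fs r′ , h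

  prunedDet  : ∀ {k} → Vec ℕ k → Vec ℕ k → ℤ
  prunedTerm : ∀ {k} → ℕ → Vec ℕ k → Vec ℕ (suc k) → Fin (suc k) → ℤ

  prunedDet []      []    = 1ℤ
  prunedDet (i ∷ ρ) σ     = sumFin _ (prunedTerm i ρ σ)

  prunedTerm i ρ σ j =
    if isZero (E i (lookup σ j)) ∨ zeroRowAfterDeleting (lookup σ j) ρ (removeAt σ j) then 0ℤ
    else sign (toℕ j) * E i (lookup σ j) * prunedDet ρ (removeAt σ j)

  prunedDet-sound : ∀ {k} (ρ σ : Vec ℕ k) → prunedDet ρ σ ≡ det k (labelled ρ σ)
  prunedDet-sound []      []    = refl
  prunedDet-sound {suc k} (i ∷ ρ) σ = sumFin-cong (suc k) term-sound
    where
    M = labelled (i ∷ ρ) σ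
    minor≡ : ∀ j r c → labelled ρ (removeAt σ j) r c ≡ minor M j r c
    minor≡ j r c = cong (E (lookup ρ r)) (lookup-removeAt σ j c)
    term-sound : ∀ j → prunedTerm i ρ σ j ≡ sign (toℕ j) * M fz j * det k (minor M j)
    term-sound j with isZero (E i (lookup σ j)) in entry≡0
    ... | true  = sym (laplaceTerm-zero M j (inj₁ (isZero-sound _ (Equivalence.from T-≡ entry≡0))))
    ... | false with zeroRowAfterDeleting (lookup σ j) ρ (removeAt σ j) in zeroRow
    ...   | true  =
      let r , h = zeroRowAfterDeleting-sound _ ρ (removeAt σ j) (Equivalence.from T-≡ zeroRow) in
      sym (laplaceTerm-zero M j (inj₂ (det-zero-row k (minor M j) r λ c → trans (sym (minor≡ j r c)) (h c))))
    ...   | false = cong (sign (toℕ j) * M fz j *_)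
                      (trans (prunedDet-sound ρ (removeAt σ j)) (det-cong k (minor≡ j)))

  prunedDeterminant : ℕ → ℤ
  prunedDeterminant k = prunedDet (tabulate {n = k} toℕ) (tabulate toℕ)

  prunedDeterminant-sound : ∀ k → prunedDeterminant k ≡ det k (λ r c → E (toℕ r) (toℕ c))
  prunedDeterminant-sound k = trans (prunedDet-sound (tabulate {n = k} toℕ) (tabulate toℕ))
    (det-cong k λ r c → cong₂ E (VecP.lookup∘tabulate toℕ r) (VecP.lookup∘tabulate toℕ c))

IsUnit : ℤ → Set
IsUnit z = ∣ z ∣ ≡ 1

isUnit-* : ∀ a b → IsUnit a → IsUnit b → IsUnit (a * b)
isUnit-* a b ua ub = trans (ℤP.abs-* a b) (cong₂ _*ℕ_ ua ub)

isUnit-sign : ∀ k → IsUnit (sign k)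
isUnit-sign zero    = refl
isUnit-sign (suc k) = trans (ℤP.∣-i∣≡∣i∣ (sign k)) (isUnit-sign k)

isUnit⇒∤ : ∀ {d z} → 1 < d → IsUnit z → ¬ (+ d Unsigned.∣ z)
isUnit⇒∤ 1<d uz d∣z = ℕP.<⇒≢ 1<d (sym (ℕ∣.∣1⇒≡1 (subst (_ ℕ∣.∣_) uz d∣z)))

det-pivot-isUnit : ∀ k (M : Fin (suc k) → Fin (suc k) → ℤ) j₀ →
  (∀ j → j ≢ j₀ → M fz j ≡ 0ℤ ⊎ det k (minor M j) ≡ 0ℤ) →
  IsUnit (M fz j₀) → IsUnit (det k (minor M j₀)) → IsUnit (det (suc k) M)
det-pivot-isUnit k M j₀ h u-entry u-minor = subst IsUnit (sym (det-pivot k M j₀ h))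
  (isUnit-* (sign (toℕ j₀) * M fz j₀) (det k (minor M j₀))
    (isUnit-* (sign (toℕ j₀)) (M fz j₀) (isUnit-sign (toℕ j₀)) u-entry) u-minor)

-- Sylvester matrices

private
  ≡true : ∀ {b} → T b → b ≡ true
  ≡true = Equivalence.to T-≡

  ≡false : ∀ {b} → ¬ T b → b ≡ false
  ≡false {false} _  = refl
  ≡false {true}  ¬t = ⊥-elim (¬t _)

shiftedRow : ℕ → (ℕ → ℤ) → ℕ → ℕ → ℤ
shiftedRow N c k j = if (k ≤ᵇ j) ∧ ((j ∸ k) ≤ᵇ N) then c (j ∸ k) else 0ℤ

-- sylEntry n c is, definitionally, sylvester n c (derivative n c).
sylvester : ℕ → (ℕ → ℤ) → (ℕ → ℤ) → ℕ → ℕ → ℤ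
sylvester n c d i j =
  if i <ᵇ n ∸ 1 then shiftedRow n c i j else shiftedRow (n ∸ 1) d (i ∸ (n ∸ 1)) j

derivative : ℕ → (ℕ → ℤ) → ℕ → ℤ
derivative n c p = + (n ∸ p) * c p

monomial : ℕ → ℤ → ℕ → ℤ
monomial s v p = if p ≡ᵇ s then v else 0ℤ

monomial-at : ∀ s v → monomial s v s ≡ v
monomial-at s v rewrite ≡true (ℕP.≡⇒≡ᵇ s s refl) = refl

monomial-off : ∀ {s p} v → p ≢ s → monomial s v p ≡ 0ℤ
monomial-off {s} {p} v p≢s rewrite ≡false (p≢s ∘ ℕP.≡ᵇ⇒≡ p s) = refl

shiftedRow-below : ∀ N c {k j} → j < k → shiftedRow N c k j ≡ 0ℤ
shiftedRow-below N c {k} {j} j<k rewrite ≡false (ℕP.<⇒≱ j<k ∘ ℕP.≤ᵇ⇒≤ k j) = refl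

shiftedRow-above : ∀ N c {k j} → k +ℕ N < j → shiftedRow N c k j ≡ 0ℤ
shiftedRow-above N c {k} {j} k+N<j
  rewrite ≡true (ℕP.≤⇒≤ᵇ (ℕP.≤-trans (ℕP.m≤m+n k N) (ℕP.<⇒≤ k+N<j)))
        | ≡false (ℕP.<⇒≱ (ℕP.m+n≤o⇒m≤o∸n (suc N) (subst (_≤ j) (cong suc (ℕP.+-comm k N)) k+N<j))
                    ∘ ℕP.≤ᵇ⇒≤ (j ∸ k) N) = refl

shiftedRow-at : ∀ N c k {p} → p ≤ N → shiftedRow N c k (p +ℕ k) ≡ c p
shiftedRow-at N c k {p} p≤N
  rewrite ≡true (ℕP.≤⇒≤ᵇ (ℕP.m≤n+m k p)) | ℕP.m+n∸n≡m p k | ≡true (ℕP.≤⇒≤ᵇ p≤N) = refl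

shiftedRow-monomial-off : ∀ N {s} v {k j} → j ≢ s +ℕ k → shiftedRow N (monomial s v) k j ≡ 0ℤ
shiftedRow-monomial-off N {s} v {k} {j} j≢s+k with k ≤ᵇ j in k≤j
... | false = refl
... | true with (j ∸ k) ≤ᵇ N
...   | false = refl
...   | true  = monomial-off v λ j∸k≡s → j≢s+k (begin
        j             ≡⟨ ℕP.m∸n+n≡m (ℕP.≤ᵇ⇒≤ k j (Equivalence.from T-≡ k≤j)) ⟨
        (j ∸ k) +ℕ k  ≡⟨ cong (_+ℕ k) j∸k≡s ⟩
        s +ℕ k        ∎)
  where open ≡-Reasoning

module _ {m : ℕ} where
  open Congruence m

  shiftedRow-cong : ∀ N {c c′ : ℕ → ℤ} → (∀ p → p ≤ N → c p ≈ c′ p) →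
    ∀ k j → shiftedRow N c k j ≈ shiftedRow N c′ k j
  shiftedRow-cong N c≈c′ k j with (k ≤ᵇ j) ∧ ((j ∸ k) ≤ᵇ N) in inRange
  ... | true  = c≈c′ (j ∸ k) (ℕP.≤ᵇ⇒≤ (j ∸ k) N
                 (proj₂ (Equivalence.to T-∧ (Equivalence.from T-≡ inRange))))
  ... | false = ≈-refl

  sylvester-cong : ∀ n {c c′ d d′ : ℕ → ℤ} →
    (∀ p → p ≤ n → c p ≈ c′ p) → (∀ p → p ≤ n ∸ 1 → d p ≈ d′ p) →
    ∀ i j → sylvester n c d i j ≈ sylvester n c′ d′ i j
  sylvester-cong n c≈c′ d≈d′ i j with i <ᵇ n ∸ 1
  ... | true  = shiftedRow-cong n c≈c′ i j
  ... | false = shiftedRow-cong (n ∸ 1) d≈d′ (i ∸ (n ∸ 1)) j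

toℕ-punchIn-< : ∀ {k} (i : Fin (suc k)) (j : Fin k) → toℕ j < toℕ i → toℕ (punchIn i j) ≡ toℕ j
toℕ-punchIn-< (fs i) fz     _         = refl
toℕ-punchIn-< (fs i) (fs j) (s≤s j<i) = cong suc (toℕ-punchIn-< i j j<i)

toℕ-punchIn-≥ : ∀ {k} (i : Fin (suc k)) (j : Fin k) → toℕ i ≤ toℕ j → toℕ (punchIn i j) ≡ suc (toℕ j)
toℕ-punchIn-≥ fz     j      _         = refl
toℕ-punchIn-≥ (fs i) (fs j) (s≤s i≤j) = cong suc (toℕ-punchIn-≥ i j i≤j)

-- The Sylvester matrix of c and v·x^(n1-s). Expanding along first rows, the rows i < s of c pivot
-- on c 0 (column i), the other rows of c on c n (column i + n) and the monomial rows on v; every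
-- other Laplace term has a zero entry, or a minor with a zero row or column.
module MonomialSylvester (n1 s : ℕ) (s≤n1 : s ≤ n1) (c : ℕ → ℤ) (v : ℤ) where

  n : ℕ
  n = suc n1

  E : ℕ → ℕ → ℤ
  E = sylvester n c (monomial s v)

  block : ∀ {k} → (Fin k → ℕ) → (Fin k → ℕ) → Fin k → Fin k → ℤ
  block ρ σ r c = E (ρ r) (σ c)

  cRow : ∀ {i} j → i < n1 → E i j ≡ shiftedRow n c i j
  cRow {i} j i<n1 rewrite ≡true (ℕP.<⇒<ᵇ i<n1) = refl

  vRow : ∀ t j → E (t +ℕ n1) j ≡ shiftedRow n1 (monomial s v) t j
  vRow t j rewrite ≡false (λ h → ℕP.<⇒≱ (ℕP.<ᵇ⇒< (t +ℕ n1) n1 h) (ℕP.m≤n+m n1 t))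
                 | ℕP.m+n∸n≡m t n1 = refl

  vRow-off : ∀ t {j} → j ≢ s +ℕ t → E (t +ℕ n1) j ≡ 0ℤ
  vRow-off t j≢s+t = trans (vRow t _) (shiftedRow-monomial-off n1 {s} v {t} j≢s+t)

  vRow-on : ∀ t → E (t +ℕ n1) (s +ℕ t) ≡ v
  vRow-on t = trans (vRow t _) (trans (shiftedRow-at n1 (monomial s v) t s≤n1) (monomial-at s v))

  leadingColumn-zero : ∀ {i r} → i < s → i < r → E r i ≡ 0ℤ
  leadingColumn-zero {i} {r} i<s i<r with r ℕP.<? n1
  ... | yes r<n1 = trans (cRow i r<n1) (shiftedRow-below n c i<r)
  ... | no  r≮n1 = begin
    E r i                  ≡⟨ cong (λ r → E r i) (ℕP.m∸n+n≡m (ℕP.≮⇒≥ r≮n1)) ⟨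
    E ((r ∸ n1) +ℕ n1) i   ≡⟨ vRow-off (r ∸ n1) (ℕP.<⇒≢ (ℕP.<-≤-trans i<s (ℕP.m≤m+n s (r ∸ n1)))) ⟩
    0ℤ                     ∎
    where open ≡-Reasoning

  vPivots-isUnit : IsUnit v → ∀ k t (ρ σ : Fin k → ℕ) →
    (∀ r → ρ r ≡ (toℕ r +ℕ t) +ℕ n1) → (∀ c → σ c ≡ s +ℕ (toℕ c +ℕ t)) →
    IsUnit (det k (block ρ σ))
  vPivots-isUnit uv zero    t ρ σ ρ≡ σ≡ = refl
  vPivots-isUnit uv (suc k) t ρ σ ρ≡ σ≡ =
    det-pivot-isUnit k (block ρ σ) fz offPivot
      (subst IsUnit (sym (trans (cong₂ E (ρ≡ fz) (σ≡ fz)) (vRow-on t))) uv)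
      (vPivots-isUnit uv k (suc t) (ρ ∘ fs) (σ ∘ fs)
        (λ r → trans (ρ≡ (fs r)) (cong (_+ℕ n1) (sym (ℕP.+-suc (toℕ r) t))))
        (λ c → trans (σ≡ (fs c)) (cong (s +ℕ_) (sym (ℕP.+-suc (toℕ c) t)))))
    where
    offPivot : ∀ j → j ≢ fz → block ρ σ fz j ≡ 0ℤ ⊎ det k (minor (block ρ σ) j) ≡ 0ℤ
    offPivot fz     j≢0 = ⊥-elim (j≢0 refl)
    offPivot (fs j) _   = inj₁ (trans (cong₂ E (ρ≡ fz) (σ≡ (fs j)))
      (vRow-off t λ eq → ℕP.m≢1+n+m t (sym (ℕP.+-cancelˡ-≡ s _ _ eq))))

  module CnPivot {w i} (ρ σ : Fin (suc (w +ℕ n)) → ℕ) (s≤i : s ≤ i) (i+w≡n1 : i +ℕ suc w ≡ n1)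
    (ρ≡ : ∀ r → ρ r ≡ toℕ r +ℕ i)
    (σ≡ₗ : ∀ c → toℕ c < n → σ c ≡ s +ℕ toℕ c) (σ≡ᵣ : ∀ c → n ≤ toℕ c → σ c ≡ toℕ c +ℕ i) where

    open ≡-Reasoning

    n<1+w+n : n < suc (w +ℕ n)
    n<1+w+n = s≤s (ℕP.m≤n+m n w)

    j₀ : Fin (suc (w +ℕ n))
    j₀ = fromℕ< n<1+w+n

    toℕ-j₀ : toℕ j₀ ≡ n
    toℕ-j₀ = FinP.toℕ-fromℕ< n<1+w+n

    i<n1 : i < n1
    i<n1 = subst (i <_) i+w≡n1 (ℕP.m<m+n i (s≤s z≤n))

    pivot : block ρ σ fz j₀ ≡ c n
    pivot = begin
      E (ρ fz) (σ j₀)           ≡⟨ cong₂ E (ρ≡ fz) (σ≡ᵣ j₀ (ℕP.≤-reflexive (sym toℕ-j₀))) ⟩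
      E i (toℕ j₀ +ℕ i)         ≡⟨ cong (λ x → E i (x +ℕ i)) toℕ-j₀ ⟩
      E i (n +ℕ i)              ≡⟨ cRow _ i<n1 ⟩
      shiftedRow n c i (n +ℕ i) ≡⟨ shiftedRow-at n c i ℕP.≤-refl ⟩
      c n                       ∎

    minorColumnsₗ : ∀ c → toℕ c < n → σ (punchIn j₀ c) ≡ s +ℕ toℕ c
    minorColumnsₗ c c<n = trans (σ≡ₗ (punchIn j₀ c) (subst (_< n) (sym punch≡) c<n)) (cong (s +ℕ_) punch≡)
      where punch≡ = toℕ-punchIn-< j₀ c (subst (toℕ c <_) (sym toℕ-j₀) c<n)

    minorColumnsᵣ : ∀ c → n ≤ toℕ c → σ (punchIn j₀ c) ≡ toℕ c +ℕ suc i
    minorColumnsᵣ c n≤c = begin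
      σ (punchIn j₀ c)            ≡⟨ σ≡ᵣ (punchIn j₀ c) (subst (n ≤_) (sym punch≡) (ℕP.m≤n⇒m≤1+n n≤c)) ⟩
      toℕ (punchIn j₀ c) +ℕ i     ≡⟨ cong (_+ℕ i) punch≡ ⟩
      suc (toℕ c) +ℕ i            ≡⟨ ℕP.+-suc (toℕ c) i ⟨
      toℕ c +ℕ suc i              ∎
      where punch≡ = toℕ-punchIn-≥ j₀ c (subst (_≤ toℕ c) (sym toℕ-j₀) n≤c)

    column-injective : ∀ t c → t < n → toℕ c ≢ t → σ c ≢ s +ℕ t
    column-injective t c t<n c≢t with toℕ c ℕP.<? n
    ... | yes c<n = λ eq → c≢t (ℕP.+-cancelˡ-≡ s _ _ (trans (sym (σ≡ₗ c c<n)) eq))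
    ... | no  c≮n = λ eq → ℕP.<⇒≢ s+t<σc (sym eq)
      where
      s+t<σc : s +ℕ t < σ c
      s+t<σc = subst (s +ℕ t <_) (sym (σ≡ᵣ c (ℕP.≮⇒≥ c≮n)))
        (subst (s +ℕ t <_) (ℕP.+-comm i (toℕ c))
          (ℕP.+-mono-≤-< s≤i (ℕP.<-≤-trans t<n (ℕP.≮⇒≥ c≮n))))

    vRowOf : ∀ (j : Fin (suc (w +ℕ n))) → toℕ j < n → Fin (w +ℕ n)
    vRowOf j j<n = fromℕ< (subst (toℕ j +ℕ w <_) (ℕP.+-comm n w) (ℕP.+-monoˡ-< w j<n))

    vRowOf-index : ∀ j j<n → ρ (fs (vRowOf j j<n)) ≡ toℕ j +ℕ n1
    vRowOf-index j j<n = begin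
      ρ (fs (vRowOf j j<n))          ≡⟨ ρ≡ (fs (vRowOf j j<n)) ⟩
      suc (toℕ (vRowOf j j<n)) +ℕ i  ≡⟨ cong (λ x → suc x +ℕ i) (FinP.toℕ-fromℕ< _) ⟩
      suc (toℕ j +ℕ w) +ℕ i          ≡⟨ rearrange (toℕ j) w i ⟩
      toℕ j +ℕ (i +ℕ suc w)          ≡⟨ cong (toℕ j +ℕ_) i+w≡n1 ⟩
      toℕ j +ℕ n1                    ∎
      where
      rearrange : ∀ a b c → suc (a +ℕ b) +ℕ c ≡ a +ℕ (c +ℕ suc b)
      rearrange = ℕ-solve-∀

    offPivot : ∀ (j : Fin (suc (w +ℕ n))) → j ≢ j₀ →
      block ρ σ fz j ≡ 0ℤ ⊎ det (w +ℕ n) (minor (block ρ σ) j) ≡ 0ℤ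
    offPivot j j≢j₀ with ℕP.<-cmp (toℕ j) n
    ... | tri< j<n _ _ = inj₂ (det-zero-row (w +ℕ n) (minor (block ρ σ) j) (vRowOf j j<n) λ c →
          trans (cong (λ r → E r (σ (punchIn j c))) (vRowOf-index j j<n))
                (vRow-off (toℕ j) (column-injective (toℕ j) (punchIn j c) j<n
                  (FinP.punchInᵢ≢i j c ∘ FinP.toℕ-injective))))
    ... | tri≈ _ j≡n _ = ⊥-elim (j≢j₀ (FinP.toℕ-injective (trans j≡n (sym toℕ-j₀))))
    ... | tri> _ _ n<j = inj₁ (begin
          E (ρ fz) (σ j)                ≡⟨ cong₂ E (ρ≡ fz) (σ≡ᵣ j (ℕP.<⇒≤ n<j)) ⟩
          E i (toℕ j +ℕ i)              ≡⟨ cRow _ i<n1 ⟩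
          shiftedRow n c i (toℕ j +ℕ i) ≡⟨ shiftedRow-above n c i+n<j+i ⟩
          0ℤ                            ∎)
      where
      i+n<j+i : i +ℕ n < toℕ j +ℕ i
      i+n<j+i = subst (_< toℕ j +ℕ i) (ℕP.+-comm n i) (ℕP.+-monoˡ-< i n<j)

  cnPivots-isUnit : IsUnit (c n) → IsUnit v →
    ∀ w i (ρ σ : Fin (w +ℕ n) → ℕ) → s ≤ i → i +ℕ w ≡ n1 → (∀ r → ρ r ≡ toℕ r +ℕ i) →
    (∀ c → toℕ c < n → σ c ≡ s +ℕ toℕ c) → (∀ c → n ≤ toℕ c → σ c ≡ toℕ c +ℕ i) →
    IsUnit (det (w +ℕ n) (block ρ σ))
  cnPivots-isUnit ucn uv zero i ρ σ _ i+0≡n1 ρ≡ σ≡ₗ _ =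
    vPivots-isUnit uv n 0 ρ σ
      (λ r → trans (ρ≡ r) (cong₂ _+ℕ_ (sym (ℕP.+-identityʳ (toℕ r))) (trans (sym (ℕP.+-identityʳ i)) i+0≡n1)))
      (λ c → trans (σ≡ₗ c (FinP.toℕ<n c)) (cong (s +ℕ_) (sym (ℕP.+-identityʳ (toℕ c)))))
  cnPivots-isUnit ucn uv (suc w) i ρ σ s≤i i+w≡n1 ρ≡ σ≡ₗ σ≡ᵣ =
    det-pivot-isUnit (w +ℕ n) (block ρ σ) j₀ offPivot (subst IsUnit (sym pivot) ucn)
      (cnPivots-isUnit ucn uv w (suc i) (ρ ∘ fs) (σ ∘ punchIn j₀) (ℕP.m≤n⇒m≤1+n s≤i)
        (trans (sym (ℕP.+-suc i w)) i+w≡n1) (λ r → trans (ρ≡ (fs r)) (sym (ℕP.+-suc (toℕ r) i)))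
        minorColumnsₗ minorColumnsᵣ)
    where open CnPivot ρ σ s≤i i+w≡n1 ρ≡ σ≡ₗ σ≡ᵣ

  c0Pivots-isUnit : c 0 ≡ 1ℤ → IsUnit (c n) → IsUnit v →
    ∀ u i (ρ σ : Fin (u +ℕ ((n1 ∸ s) +ℕ n)) → ℕ) → i +ℕ u ≡ s →
    (∀ r → ρ r ≡ toℕ r +ℕ i) → (∀ c → σ c ≡ toℕ c +ℕ i) →
    IsUnit (det (u +ℕ ((n1 ∸ s) +ℕ n)) (block ρ σ))
  c0Pivots-isUnit c0 ucn uv zero i ρ σ i+0≡s ρ≡ σ≡ =
    cnPivots-isUnit ucn uv (n1 ∸ s) i ρ σ (ℕP.≤-reflexive (sym i≡s))
      (trans (cong (_+ℕ (n1 ∸ s)) i≡s) (ℕP.m+[n∸m]≡n s≤n1)) ρ≡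
      (λ c _ → trans (σ≡ c) (trans (cong (toℕ c +ℕ_) i≡s) (ℕP.+-comm (toℕ c) s)))
      (λ c _ → σ≡ c)
    where
    i≡s : i ≡ s
    i≡s = trans (sym (ℕP.+-identityʳ i)) i+0≡s
  c0Pivots-isUnit c0 ucn uv (suc u) i ρ σ i+u≡s ρ≡ σ≡ =
    det-pivot-isUnit (u +ℕ ((n1 ∸ s) +ℕ n)) (block ρ σ) fz offPivot (subst IsUnit (sym pivot) refl)
      (c0Pivots-isUnit c0 ucn uv u (suc i) (ρ ∘ fs) (σ ∘ fs) (trans (sym (ℕP.+-suc i u)) i+u≡s)
        (λ r → trans (ρ≡ (fs r)) (sym (ℕP.+-suc (toℕ r) i)))
        (λ c → trans (σ≡ (fs c)) (sym (ℕP.+-suc (toℕ c) i))))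
    where
    i<s : i < s
    i<s = subst (i <_) i+u≡s (ℕP.m<m+n i (s≤s z≤n))
    pivot : block ρ σ fz fz ≡ 1ℤ
    pivot = trans (cong₂ E (ρ≡ fz) (σ≡ fz))
      (trans (cRow i (ℕP.<-≤-trans i<s s≤n1)) (trans (shiftedRow-at n c i z≤n) c0))
    offPivot : ∀ j → j ≢ fz →
      block ρ σ fz j ≡ 0ℤ ⊎ det (u +ℕ ((n1 ∸ s) +ℕ n)) (minor (block ρ σ) j) ≡ 0ℤ
    offPivot j j≢0 = inj₂ (det-zero-col _ (minor (block ρ σ) j) (punchOut j≢0) λ r →
      trans (cong (block ρ σ (fs r)) (FinP.punchIn-punchOut j≢0))
            (trans (cong₂ E (ρ≡ (fs r)) (σ≡ fz)) (leadingColumn-zero i<s (s≤s (ℕP.m≤n+m i (toℕ r))))))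

  sylvester-isUnit : c 0 ≡ 1ℤ → IsUnit (c n) → IsUnit v →
    IsUnit (det (n +ℕ n1) (λ r c → E (toℕ r) (toℕ c)))
  sylvester-isUnit c0 ucn uv = subst (λ k → IsUnit (det k (block toℕ toℕ))) size
    (c0Pivots-isUnit c0 ucn uv s 0 toℕ toℕ refl
      (λ r → sym (ℕP.+-identityʳ (toℕ r))) (λ c → sym (ℕP.+-identityʳ (toℕ c))))
    where
    size : s +ℕ ((n1 ∸ s) +ℕ n) ≡ n +ℕ n1
    size = trans (sym (ℕP.+-assoc s (n1 ∸ s) n))
      (trans (cong (_+ℕ n) (ℕP.m+[n∸m]≡n s≤n1)) (ℕP.+-comm n1 n))

-- Reduction modulo 3

open Congruence 3

coeff : (g : ℕ) → Coeffs g → ℕ → ℤ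
coeff g a = nth (fDesc g a)

infix 4 _≋_
_≋_ : ∀ {k} → Vec ℤ k → Vec ℤ k → Set
a ≋ b = ∀ i → lookup a i ≈ lookup b i

coeff-cong : ∀ g {a b : Coeffs g} → a ≋ b → ∀ p → coeff g a p ≈ coeff g b p
coeff-cong g         a≋b zero          = ≈-refl
coeff-cong g         a≋b (suc zero)    = ≈-refl
coeff-cong g {a} {b} a≋b (suc (suc p)) = nth-toList-cong a b a≋b p
  where
  nth-toList-cong : ∀ {k} (a b : Vec ℤ k) → a ≋ b → ∀ p → nth (toList a) p ≈ nth (toList b) p
  nth-toList-cong []      []      _ p       = ≈-refl
  nth-toList-cong (x ∷ a) (y ∷ b) h zero    = h fz
  nth-toList-cong (x ∷ a) (y ∷ b) h (suc p) = nth-toList-cong a b (h ∘ fs) p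

goodReduction-cong : ∀ g {a b : Coeffs g} → a ≋ b → GoodReductionAt3 g b → GoodReductionAt3 g a
goodReduction-cong g {a} {b} a≋b good 3∣res = good (∣-resp-≈ resultant≈ 3∣res)
  where
  resultant≈ : resultantFF' g a ≈ resultantFF' g b
  resultant≈ = det-cong-≈ (deg g +ℕ 2 *ℕ g) λ r c → sylvester-cong (deg g)
    {coeff g a} {coeff g b} {derivative (deg g) (coeff g a)} {derivative (deg g) (coeff g b)}
    (λ p _ → coeff-cong g a≋b p) (λ p _ → *-cong (≈-refl {+ (deg g ∸ p)}) (coeff-cong g a≋b p))
    (toℕ r) (toℕ c)

goodReduction-of-monomialDerivative : ∀ g (a : Coeffs g) s v → s ≤ 2 *ℕ g → IsUnit v →
  IsUnit (coeff g a (deg g)) →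
  (∀ p → p < deg g → derivative (deg g) (coeff g a) p ≈ monomial s v p) → GoodReductionAt3 g a
goodReduction-of-monomialDerivative g a s v s≤2g uv uc f′≈ =
  isUnit⇒∤ {3} {sylvesterDet} (s≤s (s≤s z≤n)) sylvesterDet-isUnit ∘ ∣-resp-≈ resultant≈
  where
  sylvesterDet : ℤ
  sylvesterDet = det (deg g +ℕ 2 *ℕ g) λ r c → sylvester (deg g) (coeff g a) (monomial s v) (toℕ r) (toℕ c)
  sylvesterDet-isUnit : IsUnit sylvesterDet
  sylvesterDet-isUnit = MonomialSylvester.sylvester-isUnit (2 *ℕ g) s s≤2g (coeff g a) v refl uc uv
  resultant≈ : resultantFF' g a ≈ sylvesterDet
  resultant≈ = det-cong-≈ (deg g +ℕ 2 *ℕ g) λ r c → sylvester-cong (deg g)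
    {coeff g a} {coeff g a} {derivative (deg g) (coeff g a)} {monomial s v}
    (λ _ _ → ≈-refl) (λ p p≤2g → f′≈ p (s≤s p≤2g)) (toℕ r) (toℕ c)

goodReductionAt3? : ∀ g a → Dec (GoodReductionAt3 g a)
goodReductionAt3? g a =
  map′ (λ h → h ∘ subst (λ z → 3 ℕ∣.∣ ∣ z ∣) (sym resultant≡))
       (λ h → h ∘ subst (λ z → 3 ℕ∣.∣ ∣ z ∣) resultant≡)
       (¬? (3 ℕ∣.∣? ∣ prunedDeterminant (deg g +ℕ 2 *ℕ g) ∣))
  where
  open PrunedExpansion (sylEntry (deg g) (coeff g a))
  resultant≡ : prunedDeterminant (deg g +ℕ 2 *ℕ g) ≡ resultantFF' g a
  resultant≡ = prunedDeterminant-sound (deg g +ℕ 2 *ℕ g)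

-- Points over 𝔽₃ and 𝔽₉

hornerStep : F9 → F9 → ℤ → F9
hornerStep x acc c = (acc *₉ x) +₉ embed (redℤ c)

evalF9-cong : ∀ g {a b : Coeffs g} → a ≋ b → ∀ x → evalF9 (fDesc g a) x ≡ evalF9 (fDesc g b) x
evalF9-cong g {a} {b} a≋b x = horner-cong a b a≋b _
  where
  horner-cong : ∀ {k} (a b : Vec ℤ k) → a ≋ b →
    ∀ acc → foldl (hornerStep x) acc (toList a) ≡ foldl (hornerStep x) acc (toList b)
  horner-cong []      []      _   acc = refl
  horner-cong (y ∷ a) (z ∷ b) a≋b acc =
    trans (cong (λ r → foldl (hornerStep x) ((acc *₉ x) +₉ embed r) (toList a))
                (cong toF3 (%ℕ-cong (a≋b fz))))
          (horner-cong a b (a≋b ∘ fs) _)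

-1₉ i₉ : F9
-1₉ = (fs (fs fz) , fz)
i₉  = (fz , fs fz)

NonSquare : F9 → Set
NonSquare z = ∀ y → y *₉ y ≢ z

-- The points (u , fs w) are those of 𝔽₉ ∖ 𝔽₃.
PointProfile : (F9 → F9) → Set
PointProfile V = (∀ u → V (embed u) ≡ -1₉) × (∀ u w → NonSquare (V (u , fs w)))

infix 4 _≟₉_
_≟₉_ : DecidableEquality F9
_≟₉_ = ≡-dec FinP._≟_ FinP._≟_

nonSquare? : ∀ z → Dec (NonSquare z)
nonSquare? z = map′ (λ h y → h (proj₁ y) (proj₂ y)) (λ h y₁ y₂ → h (y₁ , y₂))
  (FinP.all? λ y₁ → FinP.all? λ y₂ → ¬? ((y₁ , y₂) *₉ (y₁ , y₂) ≟₉ z))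

pointProfile? : ∀ V → Dec (PointProfile V)
pointProfile? V = (FinP.all? λ u → V (embed u) ≟₉ -1₉)
            ×-dec (FinP.all? λ u → FinP.all? λ w → nonSquare? (V (u , fs w)))

pointProfile-cong : ∀ {V W} → (∀ x → W x ≡ V x) → PointProfile V → PointProfile W
pointProfile-cong W≡V (onF3 , offF3) =
  (λ u → trans (W≡V _) (onF3 u)) , (λ u w y y²≡ → offF3 u w y (trans y²≡ (W≡V _)))

square≢-1 : ∀ u → embed u *₉ embed u ≢ -1₉
square≢-1 fz           ()
square≢-1 (fs fz)      ()
square≢-1 (fs (fs fz)) ()

square≡-1 : ∀ y → y *₉ y ≡ -1₉ → y ≡ i₉ ⊎ y ≡ neg₉ i₉
square≡-1 (fz , fz)                ()
square≡-1 (fz , fs fz)             _  = inj₁ refl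
square≡-1 (fz , fs (fs fz))        _  = inj₂ refl
square≡-1 (fs fz , fz)             ()
square≡-1 (fs fz , fs fz)          ()
square≡-1 (fs fz , fs (fs fz))     ()
square≡-1 (fs (fs fz) , fz)        ()
square≡-1 (fs (fs fz) , fs fz)     ()
square≡-1 (fs (fs fz) , fs (fs fz)) ()

curvePoints : ∀ g a → PointProfile (evalF9 (fDesc g a)) → OnlyInfinityOverF3 g a × F9PointsShape g a
curvePoints g a (onF3 , offF3) = onlyInfinity , i₉ , (λ ()) , λ x y → mk⇔ (onCurve⇒ x y) (⇒onCurve x y)
  where
  onlyInfinity : OnlyInfinityOverF3 g a
  onlyInfinity (u , .fz) (y , .fz) refl refl y²≡ = square≢-1 y (trans y²≡ (onF3 u))
  onCurve⇒ : ∀ x y → OnCurve g a x y → InF3 x × (y ≡ i₉ ⊎ y ≡ neg₉ i₉)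
  onCurve⇒ (u , fz)   y y²≡ = refl , square≡-1 y (trans y²≡ (onF3 u))
  onCurve⇒ (u , fs w) y y²≡ = ⊥-elim (offF3 u w y y²≡)
  ⇒onCurve : ∀ x y → InF3 x × (y ≡ i₉ ⊎ y ≡ neg₉ i₉) → OnCurve g a x y
  ⇒onCurve (u , .fz) .i₉          (refl , inj₁ refl) = sym (onF3 u)
  ⇒onCurve (u , .fz) .(neg₉ i₉)   (refl , inj₂ refl) = sym (onF3 u)

-- Congruence families

minimal-of-isUnit : ∀ g (a : Coeffs g) i → IsUnit (lookup a i) → Minimal g a
minimal-of-isUnit g a i ua (ℓ , ℓ-prime , ℓ^k∣a)
  with ℕP.m^n≡1⇒n≡0∨m≡1 ℓ _ (ℕ∣.∣1⇒≡1 (subst (_ ℕ∣.∣_) ua (ℓ^k∣a i)))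
... | inj₁ k≡0 = subst (λ x → 2 *ℕ x ≢ 0) (ℕP.+-comm 2 (toℕ i)) (λ ()) k≡0
... | inj₂ ℓ≡1 = ¬prime[1] (subst Prime ℓ≡1 ℓ-prime)

minimal-of-isUnit-constant : ∀ g (a : Coeffs g) → IsUnit (coeff g a (deg g)) → Minimal g a
minimal-of-isUnit-constant zero    []  ()
minimal-of-isUnit-constant (suc g) a u =
  minimal-of-isUnit (suc g) a (fromℕ _) (trans (cong ∣_∣ (sym (nth-toList-last a))) u)
  where
  nth-toList-last : ∀ {k} (a : Vec ℤ (suc k)) → nth (toList a) k ≡ lookup a (fromℕ k)
  nth-toList-last (x ∷ [])    = refl
  nth-toList-last (x ∷ y ∷ a) = nth-toList-last (y ∷ a)

separable-of-goodReduction : ∀ g a → GoodReductionAt3 g a → Separable g a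
separable-of-goodReduction g a good res≡0 = good (subst (λ r → 3 ℕ∣.∣ ∣ r ∣) (sym res≡0) (3 ℕ∣.∣0))

HasGoodCongruenceFamily : ℕ → Set
HasGoodCongruenceFamily g = Σ (List (CongCond g)) (λ conds →
  All ValidCond conds ×
  Σ (Coeffs g) (λ a → MinimalModel g a × All (SatCond a) conds) ×
  ((a : Coeffs g) → MinimalModel g a → All (SatCond a) conds →
    GoodReductionAt3 g a × OnlyInfinityOverF3 g a × F9PointsShape g a))

congruentMod3 : ∀ {g} → Coeffs g → List (CongCond g)
congruentMod3 b = List.tabulate λ i → cong-cond i 3 (lookup b i)

-- Everything required depends only on the coefficients modulo 3.
congruenceFamily : ∀ g (b : Coeffs g) → GoodReductionAt3 g b → PointProfile (evalF9 (fDesc g b)) →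
  IsUnit (coeff g b (deg g)) → HasGoodCongruenceFamily g
congruenceFamily g b good profile unit =
  congruentMod3 b , tabulate⁺ (λ _ → s≤s z≤n) ,
  (b , (separable-of-goodReduction g b good , minimal-of-isUnit-constant g b unit) ,
       tabulate⁺ (λ i → ∣⇒∣ᵤ (m∣x-y (≈-refl {lookup b i})))) ,
  λ a _ sat → let a≋b = λ i → mk≈ (∣ᵤ⇒∣ (tabulate⁻ sat i)) in
    goodReduction-cong g {a} {b} a≋b good ,
    curvePoints g a (pointProfile-cong (evalF9-cong g {a} {b} a≋b) profile)

-- Reductions with a monomial derivative

-- f̄′ = scalar · x^(2g - position): coefficients are indexed from the top degree down.
record MonomialModel (g : ℕ) : Set where
  field
    coeffs              : Coeffs g
    position            : ℕ
    scalar              : ℤ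
    position≤           : position ≤ 2 *ℕ g
    scalar-isUnit       : IsUnit scalar
    constant-isUnit     : IsUnit (coeff g coeffs (deg g))
    derivative≈monomial : ∀ p → p < deg g →
                          derivative (deg g) (coeff g coeffs) p ≈ monomial position scalar p
    profile             : PointProfile (evalF9 (fDesc g coeffs))

monomialModel-family : ∀ {g} → MonomialModel g → HasGoodCongruenceFamily g
monomialModel-family {g} M = congruenceFamily g coeffs
  (goodReduction-of-monomialDerivative g coeffs position scalar position≤ scalar-isUnit
    constant-isUnit derivative≈monomial)
  profile constant-isUnit
  where open MonomialModel M

pad : ∀ g → Coeffs g → Coeffs (12 +ℕ g)
pad g b = Vec.cast (sym (ℕP.*-distribˡ-+ 2 12 g)) (Vec.replicate 24 0ℤ Vec.++ b)

fDesc-pad : ∀ g (b : Coeffs g) →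
  fDesc (12 +ℕ g) (pad g b) ≡ (+ 1 ∷ + 0 ∷ List.replicate 24 0ℤ) List.++ toList b
fDesc-pad g b = cong (λ L → + 1 ∷ + 0 ∷ L) (begin
  toList (pad g b)                              ≡⟨ VecP.toList-cast (sym (ℕP.*-distribˡ-+ 2 12 g)) _ ⟩
  toList (Vec.replicate 24 0ℤ Vec.++ b)         ≡⟨ VecP.toList-++ (Vec.replicate 24 0ℤ) b ⟩
  toList (Vec.replicate 24 0ℤ) List.++ toList b ≡⟨ cong (List._++ toList b) (VecP.toList-replicate 24 0ℤ) ⟩
  List.replicate 24 0ℤ List.++ toList b         ∎)
  where open ≡-Reasoning

nth-zeros-++ : ∀ k (L : List ℤ) q → nth (List.replicate k 0ℤ List.++ L) (k +ℕ q) ≡ nth L q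
nth-zeros-++ zero    L q = refl
nth-zeros-++ (suc k) L q = nth-zeros-++ k L q

nth-zeros-++-< : ∀ k (L : List ℤ) {q} → q < k → nth (List.replicate k 0ℤ List.++ L) q ≡ 0ℤ
nth-zeros-++-< (suc k) L {zero}  _         = refl
nth-zeros-++-< (suc k) L {suc q} (s≤s q<k) = nth-zeros-++-< k L q<k

coeff-pad-low : ∀ g (b : Coeffs g) {q} → q < 24 → coeff (12 +ℕ g) (pad g b) (suc q) ≡ 0ℤ
coeff-pad-low g b {zero}  _          = cong (λ L → nth L 1) (fDesc-pad g b)
coeff-pad-low g b {suc q} (s≤s q<23) = trans (cong (λ L → nth L (2 +ℕ q)) (fDesc-pad g b))
  (nth-zeros-++-< 24 (toList b) (ℕP.m≤n⇒m≤1+n q<23))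

coeff-pad-high : ∀ g (b : Coeffs g) p → coeff (12 +ℕ g) (pad g b) (24 +ℕ suc p) ≡ coeff g b (suc p)
coeff-pad-high g b zero    = cong (λ L → nth L 25) (fDesc-pad g b)
coeff-pad-high g b (suc p) = trans (cong (λ L → nth L (26 +ℕ p)) (fDesc-pad g b))
  (nth-zeros-++ 24 (toList b) p)

deg-pad : ∀ g → deg (12 +ℕ g) ≡ 24 +ℕ deg g
deg-pad g = cong suc (ℕP.*-distribˡ-+ 2 12 g)

-- The multiplicative group of 𝔽₉ has order 8. Deciding the equation (rather than refl) evaluates
-- the Horner scheme with sharing.
x^25≡x : ∀ x → evalF9 (+ 1 ∷ + 0 ∷ List.replicate 24 0ℤ) x ≡ evalF9 (+ 1 ∷ + 0 ∷ []) x
x^25≡x (u , w) = toWitness {a? = FinP.all? λ u → FinP.all? λ w → powers≟ (u , w)} _ u w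
  where
  powers≟ : ∀ x → Dec (evalF9 (+ 1 ∷ + 0 ∷ List.replicate 24 0ℤ) x ≡ evalF9 (+ 1 ∷ + 0 ∷ []) x)
  powers≟ x = _ ≟₉ _

evalF9-++ : ∀ cs zs x → evalF9 (cs List.++ zs) x ≡ foldl (hornerStep x) (evalF9 cs x) zs
evalF9-++ cs zs x = LP.foldl-++ (hornerStep x) 0₉ cs zs

evalF9-pad : ∀ g (b : Coeffs g) x → evalF9 (fDesc (12 +ℕ g) (pad g b)) x ≡ evalF9 (fDesc g b) x
evalF9-pad g b x = begin
  evalF9 (fDesc (12 +ℕ g) (pad g b)) x                 ≡⟨ cong (λ L → evalF9 L x) (fDesc-pad g b) ⟩
  evalF9 (x^25 List.++ toList b) x                   ≡⟨ evalF9-++ x^25 (toList b) x ⟩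
  foldl (hornerStep x) (evalF9 x^25 x) (toList b)    ≡⟨ cong (λ acc → foldl (hornerStep x) acc (toList b)) (x^25≡x x) ⟩
  foldl (hornerStep x) (evalF9 x^1 x) (toList b)     ≡⟨ evalF9-++ x^1 (toList b) x ⟨
  evalF9 (x^1 List.++ toList b) x                    ∎
  where
  open ≡-Reasoning
  x^25 x^1 : List ℤ
  x^25 = + 1 ∷ + 0 ∷ List.replicate 24 0ℤ
  x^1  = + 1 ∷ + 0 ∷ []

padPosition : ℕ → ℕ
padPosition zero    = zero
padPosition (suc s) = 24 +ℕ suc s

padPosition-≤ : ∀ {g} s → s ≤ 2 *ℕ g → padPosition s ≤ 2 *ℕ (12 +ℕ g)
padPosition-≤ zero    _       = z≤n
padPosition-≤ {g} (suc s) s≤2g =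
  subst (24 +ℕ suc s ≤_) (sym (ℕP.*-distribˡ-+ 2 12 g)) (ℕP.+-monoʳ-≤ 24 s≤2g)

monomial-padPosition-leading : ∀ s v → monomial (padPosition s) v 0 ≡ monomial s v 0
monomial-padPosition-leading zero    v = refl
monomial-padPosition-leading (suc s) v = refl

monomial-padPosition-low : ∀ s v {q} → q < 24 → monomial (padPosition s) v (suc q) ≡ 0ℤ
monomial-padPosition-low zero    v _    = refl
monomial-padPosition-low (suc s) v q<24 =
  monomial-off v (ℕP.<⇒≢ (ℕP.<-≤-trans (s≤s q<24) (ℕP.m≤m+n 25 s)))

monomial-padPosition-high : ∀ s v p → monomial (padPosition s) v (24 +ℕ suc p) ≡ monomial s v (suc p)
monomial-padPosition-high zero    v p = refl
monomial-padPosition-high (suc s) v p = refl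

data PadIndex : ℕ → Set where
  leading : PadIndex 0
  padding : ∀ {q} → q < 24 → PadIndex (suc q)
  shifted : ∀ p → PadIndex (24 +ℕ suc p)

padIndex : ∀ p → PadIndex p
padIndex zero = leading
padIndex (suc q) with q ℕP.<? 24
... | yes q<24 = padding q<24
... | no  q≮24 = subst PadIndex (cong suc (ℕP.m+[n∸m]≡n (ℕP.≮⇒≥ q≮24))) (shifted (q ∸ 24))

padModel : ∀ {g} → MonomialModel g → MonomialModel (12 +ℕ g)
padModel {g} M = record
  { coeffs              = pad g coeffs
  ; position            = padPosition position
  ; scalar              = scalar
  ; position≤           = padPosition-≤ {g} position position≤
  ; scalar-isUnit       = scalar-isUnit
  ; constant-isUnit     = subst IsUnit (sym constant-pad) constant-isUnit
  ; derivative≈monomial = derivative-pad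
  ; profile             = pointProfile-cong (evalF9-pad g coeffs) profile
  }
  where
  open MonomialModel M
  n  = deg g
  c  = coeff g coeffs
  c′ = coeff (12 +ℕ g) (pad g coeffs)

  constant-pad : c′ (deg (12 +ℕ g)) ≡ c n
  constant-pad = trans (cong c′ (deg-pad g)) (coeff-pad-high g coeffs (2 *ℕ g))

  derivative-padIndex : ∀ {p} → PadIndex p → p < 24 +ℕ n →
    derivative (24 +ℕ n) c′ p ≈ monomial (padPosition position) scalar p
  derivative-padIndex leading _ = begin
    + (24 +ℕ n) * 1ℤ                        ≈⟨ *-cong (+[k*m+a]≈+a 8 n) (≈-refl {1ℤ}) ⟩
    + n * 1ℤ                                ≈⟨ derivative≈monomial 0 (s≤s z≤n) ⟩
    monomial position scalar 0              ≡⟨ monomial-padPosition-leading position scalar ⟨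
    monomial (padPosition position) scalar 0 ∎
    where open ≈-Reasoning
  derivative-padIndex {suc q} (padding q<24) _ = ≈-reflexive (begin
    + (24 +ℕ n ∸ suc q) * c′ (suc q)           ≡⟨ cong (+ (24 +ℕ n ∸ suc q) *_) (coeff-pad-low g coeffs q<24) ⟩
    + (24 +ℕ n ∸ suc q) * 0ℤ                   ≡⟨ ℤP.*-zeroʳ (+ (24 +ℕ n ∸ suc q)) ⟩
    0ℤ                                         ≡⟨ monomial-padPosition-low position scalar q<24 ⟨
    monomial (padPosition position) scalar (suc q) ∎)
    where open ≡-Reasoning
  derivative-padIndex (shifted p) p<24+n = begin
    + (24 +ℕ n ∸ (24 +ℕ suc p)) * c′ (24 +ℕ suc p)
      ≡⟨ cong₂ (λ k x → + k * x) (ℕP.[m+n]∸[m+o]≡n∸o 24 n (suc p)) (coeff-pad-high g coeffs p) ⟩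
    + (n ∸ suc p) * c (suc p)
      ≈⟨ derivative≈monomial (suc p) (ℕP.+-cancelˡ-< 24 (suc p) n p<24+n) ⟩
    monomial position scalar (suc p)
      ≡⟨ monomial-padPosition-high position scalar p ⟨
    monomial (padPosition position) scalar (24 +ℕ suc p)
      ∎
    where open ≈-Reasoning

  derivative-pad : ∀ p → p < deg (12 +ℕ g) →
    derivative (deg (12 +ℕ g)) c′ p ≈ monomial (padPosition position) scalar p
  derivative-pad p p<deg = subst (λ N → derivative N c′ p ≈ monomial (padPosition position) scalar p)
    (sym (deg-pad g)) (derivative-padIndex (padIndex p) (subst (p <_) (deg-pad g) p<deg))

-- Explicit curves

-- x^(2g+1) + Σ a·x^e over the pairs (e , a), whose exponents are distinct and below 2g.
monicWith : (g : ℕ) → List (ℕ × ℤ) → Coeffs g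
monicWith g terms = tabulate λ i → coefficientOf terms (2 *ℕ g ∸ suc (toℕ i))
  where
  coefficientOf : List (ℕ × ℤ) → ℕ → ℤ
  coefficientOf []              e = 0ℤ
  coefficientOf ((e′ , a) ∷ ts) e = if e ≡ᵇ e′ then a else coefficientOf ts e

monomialModel : ∀ g (b : Coeffs g) s v →
  {True (s ℕP.≤? 2 *ℕ g)} → {True (∣ v ∣ ℕP.≟ 1)} → {True (∣ coeff g b (deg g) ∣ ℕP.≟ 1)} →
  {True (ℕP.allUpTo? (λ p → derivative (deg g) (coeff g b) p ≈? monomial s v p) (deg g))} →
  {True (pointProfile? (evalF9 (fDesc g b)))} → MonomialModel g
monomialModel g b s v {s≤2g} {uv} {uc} {f′≈} {points} = record
  { coeffs              = b
  ; position            = s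
  ; scalar              = v
  ; position≤           = toWitness s≤2g
  ; scalar-isUnit       = toWitness uv
  ; constant-isUnit     = toWitness uc
  ; derivative≈monomial = λ p → toWitness f′≈ {p}
  ; profile             = toWitness points
  }

checkedFamily : ∀ g (b : Coeffs g) → {True (goodReductionAt3? g b)} →
  {True (pointProfile? (evalF9 (fDesc g b)))} → {True (∣ coeff g b (deg g) ∣ ℕP.≟ 1)} →
  HasGoodCongruenceFamily g
checkedFamily g b {good} {points} {uc} = congruenceFamily g b (toWitness good) (toWitness points) (toWitness uc)

model₄ : MonomialModel 4
model₄ = monomialModel 4 (monicWith 4 ((0 , -1ℤ) ∷ (1 , 1ℤ) ∷ (3 , 1ℤ) ∷ [])) 8 1ℤ

model₅ : MonomialModel 5
model₅ = monomialModel 5 (monicWith 5 ((0 , -1ℤ) ∷ (9 , -1ℤ) ∷ [])) 0 -1ℤ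

model : ∀ k → MonomialModel (7 +ℕ k)
model 0  = monomialModel 7  (monicWith 7  ((0 , -1ℤ) ∷ (5 , -1ℤ) ∷ [])) 10 1ℤ
model 1  = monomialModel 8  (monicWith 8  ((0 , -1ℤ) ∷ (3 , -1ℤ) ∷ [])) 0 -1ℤ
model 2  = monomialModel 9  (monicWith 9  ((0 , -1ℤ) ∷ (9 , -1ℤ) ∷ [])) 0 1ℤ
model 3  = monomialModel 10 (monicWith 10 ((0 , -1ℤ) ∷ (7 , -1ℤ) ∷ [])) 14 -1ℤ
model 4  = monomialModel 11 (monicWith 11 ((0 , -1ℤ) ∷ (3 , 1ℤ) ∷ (9 , -1ℤ) ∷ (15 , -1ℤ) ∷ [])) 0 -1ℤ
model 5  = monomialModel 12 (monicWith 12 ((0 , -1ℤ) ∷ (3 , -1ℤ) ∷ [])) 0 1ℤ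
model 6  = monomialModel 13 (monicWith 13 ((0 , -1ℤ) ∷ (1 , -1ℤ) ∷ [])) 26 -1ℤ
model 7  = monomialModel 14 (monicWith 14 ((0 , -1ℤ) ∷ (15 , -1ℤ) ∷ [])) 0 -1ℤ
model 8  = monomialModel 15 (monicWith 15 ((0 , -1ℤ) ∷ (3 , 1ℤ) ∷ (9 , -1ℤ) ∷ (15 , -1ℤ) ∷ [])) 0 1ℤ
model 9  = padModel model₄
model 10 = padModel model₅
model 11 = monomialModel 18 (monicWith 18 ((0 , -1ℤ) ∷ (15 , -1ℤ) ∷ [])) 0 1ℤ
model (suc (suc (suc (suc (suc (suc (suc (suc (suc (suc (suc (suc k)))))))))))) = padModel (model k)

-- Reusing the matched g keeps the goal and the supplied type syntactically equal, so that the
-- type checker never unfolds a resultant.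
lemma6p5 : (g : ℕ) → 3 ≤ g →
    Σ (List (CongCond g)) (λ conds →
      All ValidCond conds ×
      -- the family is nonempty
      Σ (Coeffs g) (λ a → MinimalModel g a × All (SatCond a) conds) ×
      -- every member of the family has the required properties
      ((a : Coeffs g) → MinimalModel g a → All (SatCond a) conds →
        GoodReductionAt3 g a × OnlyInfinityOverF3 g a × F9PointsShape g a))
lemma6p5 g@3 _ = checkedFamily g (monicWith 3 ((0 , -1ℤ) ∷ (5 , -1ℤ) ∷ []))
lemma6p5 g@4 _ = monomialModel-family {g} model₄
lemma6p5 g@5 _ = monomialModel-family {g} model₅
lemma6p5 g@6 _ = checkedFamily g (monicWith 6 ((0 , -1ℤ) ∷ (7 , -1ℤ) ∷ []))
lemma6p5 g@(suc (suc (suc (suc (suc (suc (suc k))))))) _ = monomialModel-family {g} (model k)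
lemma6p5 0 ()
lemma6p5 1 (s≤s ())
lemma6p5 2 (s≤s (s≤s ()))
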